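{- Let $F$ be a forest and let $\tau$ be a 2-switch on $F$ such that $\tau(F)$ is a forest. Then $|Z(\tau(F))-Z(F)|\le 1$, where $Z$ denotes the zero-forcing number.
   Context: Graphs are finite and simple. A 2-switch on $G$ is specified by four distinct vertices $a,b,c,d$ with $ab,cd\in E(G)$ and $ac,bd\notin E(G)$; it produces $\tau(G)=G-ab-cd+ac+bd$. A set $S$ of initially infected vertices of $G$ is a forcing set if iterating the rule "an infected vertex with exactly one uninfected neighbor infects that neighbor" eventually infects all vertices; $Z(G)$ is the minimum size of a forcing set. -}

module Defs where

open import Data.Nat using (ℕ; suc; _≤_)
open import Data.Bool using (Bool; true; false; _∧_; _∨_; if_then_else_)
open import Data.Fin using (Fin; _≟_)
open import Data.Fin.Subset using (Subset; _∈_; _∉_; ∣_∣)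
open import Data.List using (List; []; _∷_; length)
open import Data.List.Relation.Unary.Unique.Propositional using (Unique)
open import Data.Product using (Σ; _×_; ∃)
open import Relation.Binary.PropositionalEquality using (_≡_; _≢_)
open import Relation.Nullary using (¬_)
open import Relation.Nullary.Decidable using (⌊_⌋)

Adj : ℕ → Set
Adj n = Fin n → Fin n → Bool

IsSimple : ∀ {n} → Adj n → Set
IsSimple {n} G = (∀ (x y : Fin n) → G x y ≡ G y x) × (∀ (x : Fin n) → G x x ≡ false)

data IsPath {n} (G : Adj n) : List (Fin n) → Set where
  nil  : IsPath G []
  one  : ∀ x → IsPath G (x ∷ [])
  cons : ∀ x y vs → G x y ≡ true → IsPath G (y ∷ vs) → IsPath G (x ∷ y ∷ vs)

lastOr : ∀ {A : Set} → A → List A → A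
lastOr a []       = a
lastOr a (b ∷ bs) = lastOr b bs

HasCycle : ∀ {n} → Adj n → Set
HasCycle {n} G = Σ (Fin n) λ x → Σ (List (Fin n)) λ vs →
  (2 ≤ length vs) × Unique (x ∷ vs) × IsPath G (x ∷ vs) × (G (lastOr x vs) x ≡ true)

IsForest : ∀ {n} → Adj n → Set
IsForest G = IsSimple G × ¬ HasCycle G

Is2Switch : ∀ {n} → Adj n → Fin n → Fin n → Fin n → Fin n → Set
Is2Switch G a b c d =
  a ≢ b × a ≢ c × a ≢ d × b ≢ c × b ≢ d × c ≢ d ×
  G a b ≡ true × G c d ≡ true × G a c ≡ false × G b d ≡ false

samePair : ∀ {n} → Fin n → Fin n → Fin n → Fin n → Bool
samePair x y p q = (⌊ x ≟ p ⌋ ∧ ⌊ y ≟ q ⌋) ∨ (⌊ x ≟ q ⌋ ∧ ⌊ y ≟ p ⌋)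

switch : ∀ {n} → Adj n → Fin n → Fin n → Fin n → Fin n → Adj n
switch G a b c d x y =
  if samePair x y a b ∨ samePair x y c d then false
  else if samePair x y a c ∨ samePair x y b d then true
  else G x y

data Infected {n} (G : Adj n) (S : Subset n) : Fin n → Set where
  init  : ∀ {v} → v ∈ S → Infected G S v
  force : ∀ {u w} → Infected G S u → G u w ≡ true →
          (∀ x → G u x ≡ true → x ≢ w → Infected G S x) →
          Infected G S w

IsForcingSet : ∀ {n} → Adj n → Subset n → Set
IsForcingSet G S = ∀ v → Infected G S v

IsZeroForcingNumber : ∀ {n} → Adj n → ℕ → Set
IsZeroForcingNumber {n} G k =
  (Σ (Subset n) λ S → IsForcingSet G S × ∣ S ∣ ≡ k) ×
  (∀ (S : Subset n) → IsForcingSet G S → k ≤ ∣ S ∣)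

{-# OPTIONS --safe #-}
module Submission where

open import Defs
open import Data.Bool using (Bool; true; false; _∧_; _∨_)
open import Data.Bool.Properties
  using (∨-comm; ∨-zeroʳ; ∧-conicalˡ; ∧-conicalʳ; ¬-not; not-¬) renaming (_≟_ to _≟ᵇ_)
open import Data.Empty using (⊥; ⊥-elim)
open import Data.Fin using (Fin; zero; suc; _≟_)
open import Data.Fin.Properties using (any?; all?; pigeonhole; <⇒≢)
open import Data.Fin.Subset using (Subset; _∈_; _∉_; ∣_∣; _∪_; ⁅_⁆; _-_; ⊤; inside; outside)
open import Data.Fin.Subset.Properties
  using (_∈?_; ∈⊤; x∈p∪q⁺; x∈⁅x⁆; ∣⁅x⁆∣≡1; x∈p∧x≢y⇒x∈p-y; x∈p⇒∣p-x∣<∣p∣; p─q⊆p)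
open import Data.List using (List; []; _∷_; length; lookup)
open import Data.List.Membership.Propositional using () renaming (_∈_ to _∈ˡ_)
open import Data.List.Membership.Propositional.Properties using (∈-lookup)
open import Data.List.Relation.Unary.All as All using (All; []; _∷_)
open import Data.List.Relation.Unary.All.Properties using (¬Any⇒All¬)
open import Data.List.Relation.Unary.AllPairs using ([]; _∷_)
open import Data.List.Relation.Unary.Any using (here; there)
open import Data.List.Relation.Unary.Unique.Propositional using (Unique)
open import Data.Nat using (ℕ; zero; suc; _+_; _⊔_; _≤_; _<_; _≤′_; ≤′-refl; ≤′-step; z≤n; s≤s; _≤?_; _<?_)
open import Data.Nat.Induction using (<-wellFounded)
open import Data.Nat.Properties
  using (≤-refl; ≤-trans; ≤-reflexive; <-asym; n≤1+n; ≤⇒≤′; ≮⇒≥; ≰⇒>; <⇒≱; m≤m⊔n; m≤n⊔m; m≤m+n; ≤-pred;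
         +-suc; +-comm; +-identityʳ; +-monoʳ-≤)
open import Data.Product using (∃; ∃-syntax; _×_; _,_; proj₁; proj₂)
open import Data.Sum using (_⊎_; inj₁; inj₂; [_,_]′; map₁; assocˡ)
open import Data.Vec using ([]; _∷_; here; there)
open import Function using (_∘_; id)
open import Induction.WellFounded using (Acc; acc)
open import Level using (0ℓ)
open import Relation.Binary using (Rel)
open import Relation.Binary.Construct.Closure.ReflexiveTransitive using (Star; ε; _◅_; _◅◅_)
open import Relation.Binary.PropositionalEquality using (_≡_; _≢_; refl; sym; trans; cong; subst; ≡-≟-identity)
open import Relation.Nullary using (¬_; Dec; yes; no; contradiction)
open import Relation.Nullary.Decidable using (⌊_⌋; _×-dec_; _⊎-dec_; _→-dec_; ¬?)
import Relation.Nullary.Decidable as Dec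
open import Relation.Unary using (Pred)

-- Zero forcing sets and chain systems (covers by vertex-disjoint directed paths) are
-- related as follows. The forcing chains of a forcing set S of any graph G form a chain
-- system of G whose chains start in S. Conversely, in a forest the starts of any chain
-- system form a forcing set: take a vertex ℓ with at most one neighbour among the
-- vertices still to be handled; either ℓ is a start, or its chain predecessor is that
-- neighbour and forces ℓ once everything else is infected.
-- A 2-switch deletes ab and cd, cutting at most two chains. If both are cut, the pieces
-- are rejoined along ac or bd, reversing one piece first when the orientations require
-- it, so τ(G) gets a chain system with at most |S| + 1 starts. Since τ is undone by the
-- 2-switch (a, c, b, d), the bound holds in both directions.

common-bound : ∀ {n} (Q : Fin n → ℕ → Set) → (∀ x {j k} → j ≤ k → Q x j → Q x k) →
               (∀ x → ∃ (Q x)) → ∃[ K ] ∀ x → Q x K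
common-bound {zero} Q mono bounded = 0 , λ ()
common-bound {suc n} Q mono bounded =
  let (k , q) = bounded zero
      (K , qs) = common-bound (Q ∘ suc) (mono ∘ suc) (bounded ∘ suc)
  in k ⊔ K , λ { zero → mono zero (m≤m⊔n k K) q ; (suc x) → mono (suc x) (m≤n⊔m k K) (qs x) }

∣p∪q∣≤∣p∣+∣q∣ : ∀ {n} (p q : Subset n) → ∣ p ∪ q ∣ ≤ ∣ p ∣ + ∣ q ∣
∣p∪q∣≤∣p∣+∣q∣ [] [] = z≤n
∣p∪q∣≤∣p∣+∣q∣ (inside ∷ p) (inside ∷ q) = s≤s (≤-trans (∣p∪q∣≤∣p∣+∣q∣ p q) (+-monoʳ-≤ ∣ p ∣ (n≤1+n _)))
∣p∪q∣≤∣p∣+∣q∣ (inside ∷ p) (outside ∷ q) = s≤s (∣p∪q∣≤∣p∣+∣q∣ p q)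
∣p∪q∣≤∣p∣+∣q∣ (outside ∷ p) (inside ∷ q) =
  subst (suc ∣ p ∪ q ∣ ≤_) (sym (+-suc ∣ p ∣ ∣ q ∣)) (s≤s (∣p∪q∣≤∣p∣+∣q∣ p q))
∣p∪q∣≤∣p∣+∣q∣ (outside ∷ p) (outside ∷ q) = ∣p∪q∣≤∣p∣+∣q∣ p q

x∉p-x : ∀ {n} {x : Fin n} (p : Subset n) → x ∉ p - x
x∉p-x {x = zero} (_ ∷ _) ()
x∉p-x {x = suc x} (_ ∷ p) (there x∈p-x) = x∉p-x p x∈p-x

lookup-injective : ∀ {A : Set} {xs : List A} → Unique xs → ∀ i j → lookup xs i ≡ lookup xs j → i ≡ j
lookup-injective (_ ∷ _) zero zero _ = refl
lookup-injective (x∉ ∷ _) zero (suc j) e = ⊥-elim (All.lookup x∉ (∈-lookup j) e)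
lookup-injective (x∉ ∷ _) (suc i) zero e = ⊥-elim (All.lookup x∉ (∈-lookup i) (sym e))
lookup-injective (_ ∷ u) (suc i) (suc j) e = cong suc (lookup-injective u i j e)

Unique⇒length≤ : ∀ {n} {xs : List (Fin n)} → Unique xs → length xs ≤ n
Unique⇒length≤ {n} {xs} u with length xs ≤? n
... | yes ≤n = ≤n
... | no ≰n = let (i , j , i<j , e) = pigeonhole (≰⇒> ≰n) (lookup xs) in
              contradiction (lookup-injective u i j e) (<⇒≢ i<j)

module _ {A : Set} {y : A} where

  takeThrough : ∀ {xs} → y ∈ˡ xs → List A
  takeThrough {x ∷ _} (here _) = x ∷ []
  takeThrough {x ∷ _} (there p) = x ∷ takeThrough p

  length-takeThrough : ∀ {xs} (p : y ∈ˡ xs) → 1 ≤ length (takeThrough p)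
  length-takeThrough (here _) = s≤s z≤n
  length-takeThrough (there _) = s≤s z≤n

  lastOr-takeThrough : ∀ {xs} z (p : y ∈ˡ xs) → lastOr z (takeThrough p) ≡ y
  lastOr-takeThrough z (here y≡x) = sym y≡x
  lastOr-takeThrough z (there p) = lastOr-takeThrough _ p

  All-takeThrough : ∀ {P : A → Set} {xs} (p : y ∈ˡ xs) → All P xs → All P (takeThrough p)
  All-takeThrough (here _) (px ∷ _) = px ∷ []
  All-takeThrough (there p) (px ∷ pxs) = px ∷ All-takeThrough p pxs

  Unique-takeThrough : ∀ {xs} (p : y ∈ˡ xs) → Unique xs → Unique (takeThrough p)
  Unique-takeThrough (here _) (_ ∷ _) = [] ∷ []
  Unique-takeThrough (there p) (x∉ ∷ u) = All-takeThrough p x∉ ∷ Unique-takeThrough p u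

IsPath-takeThrough : ∀ {n} {G : Adj n} {y xs} (p : y ∈ˡ xs) → IsPath G xs → IsPath G (takeThrough p)
IsPath-takeThrough (here _) (one x) = one x
IsPath-takeThrough (here _) (cons x _ _ _ _) = one x
IsPath-takeThrough (there (here _)) (cons x y _ g _) = cons x y [] g (one y)
IsPath-takeThrough (there (there p)) (cons x y _ g path) = cons x y _ g (IsPath-takeThrough (there p) path)

IsLeafOf : ∀ {n} → Adj n → Subset n → Fin n → Set
IsLeafOf G A ℓ = ℓ ∈ A × (∀ {x y} → x ∈ A → y ∈ A → G ℓ x ≡ true → G ℓ y ≡ true → x ≡ y)

module _ {n} {G : Adj n} (forest : IsForest G) where
  open import Data.List.Membership.DecPropositional (_≟_ {n}) using () renaming (_∈?_ to _∈ˡ?_)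

  private
    G-sym : ∀ x y → G x y ≡ G y x
    G-sym = proj₁ (proj₁ forest)

    G-irrefl : ∀ x → G x x ≡ false
    G-irrefl = proj₂ (proj₁ forest)

    previous : Fin n → List (Fin n) → Fin n
    previous h [] = h
    previous _ (t₀ ∷ _) = t₀

    closeCycle : ∀ {h y t} → y ∈ˡ t → y ≢ previous h t → Unique (h ∷ t) → IsPath G (h ∷ t) →
                 G y h ≡ true → HasCycle G
    closeCycle (here y≡t₀) y≢t₀ _ _ _ = contradiction y≡t₀ y≢t₀
    closeCycle {h} {t = _ ∷ _} (there y∈t) _ u path yh =
      h , takeThrough (there y∈t) , s≤s (length-takeThrough y∈t) ,
      Unique-takeThrough (there (there y∈t)) u , IsPath-takeThrough (there (there y∈t)) path ,
      subst (λ z → G z h ≡ true) (sym (lastOr-takeThrough h (there y∈t))) yh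

  leaf-exists : ∀ (A : Subset n) {v} → v ∈ A → ∃[ ℓ ] IsLeafOf G A ℓ
  leaf-exists A {v} v∈A = walk n v [] ≤-refl ([] ∷ []) (one v) v∈A
    where
    -- A walk in A that never returns to the vertex it just left ends at a leaf, unless it
    -- closes a cycle or visits more than n vertices.
    walk : ∀ fuel h t → n < length (h ∷ t) + fuel → Unique (h ∷ t) → IsPath G (h ∷ t) → h ∈ A →
           ∃[ ℓ ] IsLeafOf G A ℓ
    walk zero h t long u _ _ =
      contradiction (Unique⇒length≤ u) (<⇒≱ (subst (n <_) (+-identityʳ _) long))
    walk (suc fuel) h t long u path h∈A
      with any? (λ y → (y ∈? A) ×-dec (G h y ≟ᵇ true) ×-dec ¬? (y ≟ previous h t))
    ... | no none = h , h∈A , λ x∈A y∈A hx hy → trans (onlyPrevious x∈A hx) (sym (onlyPrevious y∈A hy))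
      where
      onlyPrevious : ∀ {x} → x ∈ A → G h x ≡ true → x ≡ previous h t
      onlyPrevious {x} x∈A hx with x ≟ previous h t
      ... | yes x≡prev = x≡prev
      ... | no x≢prev = contradiction (x , x∈A , hx , x≢prev) none
    ... | yes (y , y∈A , hy , y≢prev) with y ∈ˡ? (h ∷ t)
    ...   | yes (here refl) = contradiction (trans (sym hy) (G-irrefl h)) λ ()
    ...   | yes (there y∈t) =
      contradiction (closeCycle y∈t y≢prev u path (trans (G-sym y h) hy)) (proj₂ forest)
    ...   | no y∉ = walk fuel y (h ∷ t) (subst (n <_) (+-suc (length (h ∷ t)) fuel) long)
                      (¬Any⇒All¬ _ y∉ ∷ u) (cons y h t (trans (G-sym y h) hy) path) y∈A

data ForcedAlong {n} (G : Adj n) (R : Rel (Fin n) 0ℓ) (X : Pred (Fin n) 0ℓ) : Pred (Fin n) 0ℓ where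
  start : ∀ {v} → X v → ForcedAlong G R X v
  force : ∀ {u w} → ForcedAlong G R X u → R u w →
          (∀ x → G u x ≡ true → x ≢ w → ForcedAlong G R X x) → ForcedAlong G R X w

ForcedAlong⇒Infected : ∀ {n} {G : Adj n} {R X S} → (∀ {u w} → R u w → G u w ≡ true) →
                       (∀ {v} → X v → v ∈ S) → ∀ {v} → ForcedAlong G R X v → Infected G S v
ForcedAlong⇒Infected edge initial (start x) = init (initial x)
ForcedAlong⇒Infected edge initial (force fu r others) =
  force (ForcedAlong⇒Infected edge initial fu) (edge r)
        (λ x ux x≢w → ForcedAlong⇒Infected edge initial (others x ux x≢w))

_avoiding_ : ∀ {n} → Rel (Fin n) 0ℓ → Fin n → Rel (Fin n) 0ℓ
(R avoiding ℓ) u w = R u w × u ≢ ℓ × w ≢ ℓ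

ForcedAlong-lift : ∀ {n} {G : Adj n} {R X X′ ℓ} →
  (∀ {v} → X′ v → v ≢ ℓ → ForcedAlong G R X v) →
  (∀ {u w} → (R avoiding ℓ) u w → G u ℓ ≡ true → ForcedAlong G R X ℓ) →
  ∀ {v} → ForcedAlong G (R avoiding ℓ) X′ v → v ≢ ℓ → ForcedAlong G R X v
ForcedAlong-lift initial _ (start x) v≢ℓ = initial x v≢ℓ
ForcedAlong-lift {G = G} {R} {X} {ℓ = ℓ} initial ℓ-needed (force {u} {w} fu r@(uw , u≢ℓ , _) others) _ =
  force (ForcedAlong-lift initial ℓ-needed fu u≢ℓ) uw neighbour
  where
  neighbour : ∀ x → G u x ≡ true → x ≢ w → ForcedAlong G R X x
  neighbour x ux x≢w with x ≟ ℓ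
  ... | yes refl = ℓ-needed r ux
  ... | no x≢ℓ = ForcedAlong-lift initial ℓ-needed (others x ux x≢w) x≢ℓ

-- R u w says that w follows u on its chain. Cycles of length at least 3 are not
-- excluded; a forest has none.
record IsChainSystem {n} (G : Adj n) (R : Rel (Fin n) 0ℓ) : Set where
  field
    decide     : ∀ u w → Dec (R u w)
    edge       : ∀ {u w} → R u w → G u w ≡ true
    functional : ∀ {u w w′} → R u w → R u w′ → w ≡ w′
    injective  : ∀ {u u′ w} → R u w → R u′ w → u ≡ u′
    asymmetric : ∀ {u w} → R u w → ¬ R w u

StartsIn : ∀ {n} → Rel (Fin n) 0ℓ → Pred (Fin n) 0ℓ → Set
StartsIn R P = ∀ v → P v ⊎ ∃[ u ] R u v

StartsIn-mono : ∀ {n} {R : Rel (Fin n) 0ℓ} {P Q} → (∀ {v} → P v → Q v) → StartsIn R P → StartsIn R Q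
StartsIn-mono P⊆Q starts v = map₁ P⊆Q (starts v)

record ChainSystemStartingIn {n} (G : Adj n) (P : Pred (Fin n) 0ℓ) : Set₁ where
  field
    R             : Rel (Fin n) 0ℓ
    isChainSystem : IsChainSystem G R
    starts        : StartsIn R P

IsChainSystem-⊆ : ∀ {n} {G G′ : Adj n} {R R′} → IsChainSystem G R → (∀ u w → Dec (R′ u w)) →
                  (∀ {u w} → R′ u w → R u w) → (∀ {u w} → R′ u w → G′ u w ≡ true) → IsChainSystem G′ R′
IsChainSystem-⊆ chains R′? R′⊆R edge′ = record
  { decide     = R′?
  ; edge       = edge′
  ; functional = λ r r′ → functional (R′⊆R r) (R′⊆R r′)
  ; injective  = λ r r′ → injective (R′⊆R r) (R′⊆R r′)
  ; asymmetric = λ r r′ → asymmetric (R′⊆R r) (R′⊆R r′)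
  }
  where open IsChainSystem chains

ChainSystemStartingIn-mono : ∀ {n} {G : Adj n} {P Q : Pred (Fin n) 0ℓ} → (∀ {v} → P v → Q v) →
                             ChainSystemStartingIn G P → ChainSystemStartingIn G Q
ChainSystemStartingIn-mono P⊆Q C =
  record { R = R ; isChainSystem = isChainSystem ; starts = StartsIn-mono P⊆Q starts }
  where open ChainSystemStartingIn C

-- One induction step: remove a leaf ℓ of A; the chain successor of ℓ becomes a start (P′).
module LeafRemoval {n} {G : Adj n} (forest : IsForest G)
  {A : Subset n} {R : Rel (Fin n) 0ℓ} {P : Pred (Fin n) 0ℓ}
  (chains : IsChainSystem G R) (within : ∀ {u w} → R u w → u ∈ A × w ∈ A)
  (starts : ∀ {v} → v ∈ A → P v ⊎ ∃[ u ] R u v) {ℓ} (isLeaf : IsLeafOf G A ℓ) where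
  open IsChainSystem chains

  private
    ℓ∈A : ℓ ∈ A
    ℓ∈A = proj₁ isLeaf

    leaf : ∀ {x y} → x ∈ A → y ∈ A → G ℓ x ≡ true → G ℓ y ≡ true → x ≡ y
    leaf = proj₂ isLeaf

    G-sym : ∀ x y → G x y ≡ G y x
    G-sym = proj₁ (proj₁ forest)

    G-irrefl : ∀ x → G x x ≡ false
    G-irrefl = proj₂ (proj₁ forest)

    ∈A′ : ∀ {x} → x ∈ A → x ≢ ℓ → x ∈ A - ℓ
    ∈A′ = x∈p∧x≢y⇒x∈p-y

    ∈A : ∀ {x} → x ∈ A - ℓ → x ∈ A
    ∈A = p─q⊆p A ⁅ ℓ ⁆

    ≢ℓ : ∀ {x} → x ∈ A - ℓ → x ≢ ℓ
    ≢ℓ x∈A′ refl = x∉p-x A x∈A′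

  P′ : Pred (Fin n) 0ℓ
  P′ v = P v ⊎ R ℓ v

  chains′ : IsChainSystem G (R avoiding ℓ)
  chains′ = IsChainSystem-⊆ chains (λ u w → decide u w ×-dec ¬? (u ≟ ℓ) ×-dec ¬? (w ≟ ℓ)) proj₁ (edge ∘ proj₁)

  within′ : ∀ {u w} → (R avoiding ℓ) u w → u ∈ A - ℓ × w ∈ A - ℓ
  within′ (r , u≢ℓ , w≢ℓ) = ∈A′ (proj₁ (within r)) u≢ℓ , ∈A′ (proj₂ (within r)) w≢ℓ

  starts′ : ∀ {v} → v ∈ A - ℓ → P′ v ⊎ ∃[ u ] (R avoiding ℓ) u v
  starts′ v∈A′ with starts (∈A v∈A′)
  ... | inj₁ p = inj₁ (inj₁ p)
  ... | inj₂ (u , r) with u ≟ ℓ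
  ...   | yes refl = inj₁ (inj₂ r)
  ...   | no u≢ℓ = inj₂ (u , r , u≢ℓ , ≢ℓ v∈A′)

  module _ (forced′ : ∀ {v} → v ∈ A - ℓ → ForcedAlong G (R avoiding ℓ) (λ x → P′ x ⊎ x ∉ A - ℓ) v) where
    private
      X : Pred (Fin n) 0ℓ
      X x = P x ⊎ x ∉ A

    forced-≢ℓ : (∀ {w} → R ℓ w → ForcedAlong G R X w) →
                (∀ {u w} → (R avoiding ℓ) u w → G u ℓ ≡ true → ForcedAlong G R X ℓ) →
                ∀ {v} → v ≢ ℓ → ForcedAlong G R X v
    forced-≢ℓ successor ℓ-needed {v} v≢ℓ with v ∈? A
    ... | no v∉A = start (inj₂ v∉A)
    ... | yes v∈A = ForcedAlong-lift initial ℓ-needed (forced′ (∈A′ v∈A v≢ℓ)) v≢ℓ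
      where
      initial : ∀ {x} → P′ x ⊎ x ∉ A - ℓ → x ≢ ℓ → ForcedAlong G R X x
      initial (inj₁ (inj₁ p)) _ = start (inj₁ p)
      initial (inj₁ (inj₂ r)) _ = successor r
      initial (inj₂ x∉A′) x≢ℓ = start (inj₂ (λ x∈A → x∉A′ (∈A′ x∈A x≢ℓ)))

    forced-ℓ-and-others : ForcedAlong G R X ℓ × (∀ {v} → v ≢ ℓ → ForcedAlong G R X v)
    forced-ℓ-and-others with starts ℓ∈A
    ... | inj₁ ℓ∈P = start (inj₁ ℓ∈P) , forced-≢ℓ successor (λ _ _ → start (inj₁ ℓ∈P))
      where
      successor : ∀ {w} → R ℓ w → ForcedAlong G R X w
      successor {w} r = force (start (inj₁ ℓ∈P)) r outsideA
        where
        outsideA : ∀ x → G ℓ x ≡ true → x ≢ w → ForcedAlong G R X x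
        outsideA x ℓx x≢w with x ∈? A
        ... | yes x∈A = contradiction (leaf x∈A (proj₂ (within r)) ℓx (edge r)) x≢w
        ... | no x∉A = start (inj₂ x∉A)
    ... | inj₂ (p , pℓ) = force (others p≢ℓ) pℓ (λ _ _ → others) , others
      where
      onlyNeighbour : ∀ {x} → x ∈ A → G ℓ x ≡ true → x ≡ p
      onlyNeighbour x∈A ℓx = leaf x∈A (proj₁ (within pℓ)) ℓx (trans (G-sym ℓ p) (edge pℓ))

      noSuccessor : ∀ {w} → ¬ R ℓ w
      noSuccessor r with onlyNeighbour (proj₂ (within r)) (edge r)
      ... | refl = asymmetric r pℓ

      neverNeeded : ∀ {u w} → (R avoiding ℓ) u w → G u ℓ ≡ true → ForcedAlong G R X ℓ
      neverNeeded {u} (r , _ , w≢ℓ) uℓ with onlyNeighbour (proj₁ (within r)) (trans (G-sym ℓ u) uℓ)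
      ... | refl = contradiction (functional r pℓ) w≢ℓ

      others : ∀ {v} → v ≢ ℓ → ForcedAlong G R X v
      others = forced-≢ℓ (⊥-elim ∘ noSuccessor) neverNeeded

      p≢ℓ : p ≢ ℓ
      p≢ℓ refl = contradiction (trans (sym (edge pℓ)) (G-irrefl ℓ)) λ ()

    forced : ∀ v → ForcedAlong G R X v
    forced v with v ≟ ℓ
    ... | yes refl = proj₁ forced-ℓ-and-others
    ... | no v≢ℓ = proj₂ forced-ℓ-and-others v≢ℓ

ForcedAlong-fromStarts : ∀ {n} {G : Adj n} → IsForest G → ∀ A → Acc _<_ ∣ A ∣ →
  ∀ {R : Rel (Fin n) 0ℓ} {P : Pred (Fin n) 0ℓ} → IsChainSystem G R →
  (∀ {u w} → R u w → u ∈ A × w ∈ A) → (∀ {v} → v ∈ A → P v ⊎ ∃[ u ] R u v) →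
  ∀ {v} → v ∈ A → ForcedAlong G R (λ x → P x ⊎ x ∉ A) v
ForcedAlong-fromStarts forest A (acc smaller) chains within starts {v} v∈A with leaf-exists forest A v∈A
... | ℓ , leaf = L.forced (ForcedAlong-fromStarts forest (A - ℓ) (smaller (x∈p⇒∣p-x∣<∣p∣ (proj₁ leaf)))
                                               L.chains′ L.within′ L.starts′) v
  where module L = LeafRemoval forest chains within starts leaf

chainStarts-isForcingSet : ∀ {n} {G : Adj n} {S} →
  IsForest G → ChainSystemStartingIn G (_∈ S) → IsForcingSet G S
chainStarts-isForcingSet forest C v =
  ForcedAlong⇒Infected edge [ id , (λ v∉⊤ → contradiction ∈⊤ v∉⊤) ]′
    (ForcedAlong-fromStarts forest ⊤ (<-wellFounded _) isChainSystem (λ _ → ∈⊤ , ∈⊤) (λ {v} _ → starts v) ∈⊤)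
  where
  open ChainSystemStartingIn C
  open IsChainSystem isChainSystem

CanForce : ∀ {n} → Adj n → Pred (Fin n) 0ℓ → Rel (Fin n) 0ℓ
CanForce G X u w = X u × G u w ≡ true × (∀ x → G u x ≡ true → x ≢ w → X x)

canForce? : ∀ {n} {G : Adj n} {X : Pred (Fin n) 0ℓ} → (∀ v → Dec (X v)) → ∀ u w → Dec (CanForce G X u w)
canForce? {G = G} X? u w =
  X? u ×-dec (G u w ≟ᵇ true) ×-dec all? (λ x → (G u x ≟ᵇ true) →-dec (¬? (x ≟ w) →-dec X? x))

module ForcingChains {n} {G : Adj n} {S : Subset n} (forcing : IsForcingSet G S) where

  -- In each round every possible force happens simultaneously.
  InfectedWithin : ℕ → Pred (Fin n) 0ℓ
  InfectedWithin zero v = v ∈ S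
  InfectedWithin (suc k) v = InfectedWithin k v ⊎ ∃[ u ] CanForce G (InfectedWithin k) u v

  infectedWithin? : ∀ k v → Dec (InfectedWithin k v)
  infectedWithin? zero v = v ∈? S
  infectedWithin? (suc k) v = infectedWithin? k v ⊎-dec any? (λ u → canForce? {G = G} (infectedWithin? k) u v)

  InfectedWithin-mono : ∀ {j k} → j ≤ k → ∀ {v} → InfectedWithin j v → InfectedWithin k v
  InfectedWithin-mono j≤k = go (≤⇒≤′ j≤k)
    where
    go : ∀ {j k} → j ≤′ k → ∀ {v} → InfectedWithin j v → InfectedWithin k v
    go ≤′-refl = id
    go (≤′-step j≤′k) = inj₁ ∘ go j≤′k

  Infected⇒InfectedWithin : ∀ {v} → Infected G S v → ∃[ k ] InfectedWithin k v
  Infected⇒InfectedWithin (init v∈S) = 0 , v∈S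
  Infected⇒InfectedWithin (force {u} {w} fu uw others) =
    let (k , ru) = Infected⇒InfectedWithin fu
        (K , rothers) = common-bound Q (λ x j≤k q ux x≢w → InfectedWithin-mono j≤k (q ux x≢w)) bounded
    in suc (k ⊔ K) , inj₂ (u , InfectedWithin-mono (m≤m⊔n k K) ru , uw ,
                           λ x ux x≢w → InfectedWithin-mono (m≤n⊔m k K) (rothers x ux x≢w))
    where
    Q : Fin n → ℕ → Set
    Q x k = G u x ≡ true → x ≢ w → InfectedWithin k x

    bounded : ∀ x → ∃ (Q x)
    bounded x with G u x ≟ᵇ true | x ≟ w
    ... | yes ux | no x≢w = let (k , r) = Infected⇒InfectedWithin (others x ux x≢w) in k , λ _ _ → r
    ... | yes _ | yes x≡w = 0 , λ _ x≢w → contradiction x≡w x≢w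
    ... | no ¬ux | _ = 0 , λ ux _ → contradiction ux ¬ux

  first-round : ∀ {v} k → InfectedWithin k v →
                ∃[ m ] InfectedWithin m v × (∀ {j} → j < m → ¬ InfectedWithin j v)
  first-round zero v∈S = 0 , v∈S , λ ()
  first-round {v} (suc k) r with infectedWithin? k v
  ... | yes r′ = first-round k r′
  ... | no ¬r = suc k , r , λ j<1+k rj → ¬r (InfectedWithin-mono (≤-pred j<1+k) rj)

  private
    first : ∀ v → ∃[ m ] InfectedWithin m v × (∀ {j} → j < m → ¬ InfectedWithin j v)
    first v = first-round _ (proj₂ (Infected⇒InfectedWithin (forcing v)))

  round : Fin n → ℕ
  round v = proj₁ (first v)

  infected-at-round : ∀ v → InfectedWithin (round v) v
  infected-at-round v = proj₁ (proj₂ (first v))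

  not-before-round : ∀ v {j} → j < round v → ¬ InfectedWithin j v
  not-before-round v = proj₂ (proj₂ (first v))

  round-≤ : ∀ {k v} → InfectedWithin k v → round v ≤ k
  round-≤ {v = v} r = ≮⇒≥ λ k<round → not-before-round v k<round r

  -- The other neighbours of u are infected in earlier rounds than v, so u forces at
  -- most one vertex.
  Forces : Rel (Fin n) 0ℓ
  Forces u v = CanForce G (λ x → round x < round v) u v

  forcer-exists : ∀ {v} → v ∉ S → ∃[ u ] Forces u v
  forcer-exists {v} v∉S = go (round v) (infected-at-round v) (not-before-round v)
    where
    go : ∀ m → InfectedWithin m v → (∀ {j} → j < m → ¬ InfectedWithin j v) →
         ∃[ u ] CanForce G (λ x → round x < m) u v
    go zero v∈S _ = contradiction v∈S v∉S
    go (suc m) (inj₁ r) earlier = contradiction r (earlier ≤-refl)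
    go (suc m) (inj₂ (u , ru , uv , others)) _ =
      u , s≤s (round-≤ ru) , uv , λ x ux x≢v → s≤s (round-≤ (others x ux x≢v))

  private
    forcer? : ∀ v → Dec (∃[ u ] Forces u v)
    forcer? v = any? (λ u → canForce? {G = G} (λ x → round x <? round v) u v)

    Chosen : ∀ {v} → Fin n → Dec (∃[ u ] Forces u v) → Set
    Chosen u (yes (u′ , _)) = u ≡ u′
    Chosen u (no _) = ⊥

    chosen? : ∀ {v} u (d : Dec (∃[ u ] Forces u v)) → Dec (Chosen u d)
    chosen? u (yes (u′ , _)) = u ≟ u′
    chosen? u (no _) = no id

    chosen-forces : ∀ {u v} (d : Dec (∃[ u ] Forces u v)) → Chosen u d → Forces u v
    chosen-forces (yes (_ , f)) refl = f

    chosen-unique : ∀ {u u′ v} (d : Dec (∃[ u ] Forces u v)) → Chosen u d → Chosen u′ d → u ≡ u′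
    chosen-unique (yes _) refl refl = refl

    chosen-exists : ∀ {v} (d : Dec (∃[ u ] Forces u v)) → ∃[ u ] Forces u v → ∃[ u ] Chosen u d
    chosen-exists (yes (u , _)) _ = u , refl
    chosen-exists (no none) f = contradiction f none

  ChosenForcer : Rel (Fin n) 0ℓ
  ChosenForcer u v = Chosen u (forcer? v)

  round-increasing : ∀ {u v} → ChosenForcer u v → round u < round v
  round-increasing {v = v} c = proj₁ (chosen-forces (forcer? v) c)

  isChainSystem : IsChainSystem G ChosenForcer
  isChainSystem = record
    { decide     = λ u v → chosen? u (forcer? v)
    ; edge       = λ {_} {v} c → proj₁ (proj₂ (chosen-forces (forcer? v) c))
    ; functional = functional
    ; injective  = λ {_} {_} {v} → chosen-unique (forcer? v)
    ; asymmetric = λ c c′ → <-asym (round-increasing c) (round-increasing c′)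
    }
    where
    functional : ∀ {u w w′} → ChosenForcer u w → ChosenForcer u w′ → w ≡ w′
    functional {u} {w} {w′} c c′ with w ≟ w′
    ... | yes w≡w′ = w≡w′
    ... | no w≢w′ =
      let (_ , uw , before-w) = chosen-forces (forcer? w) c
          (_ , uw′ , before-w′) = chosen-forces (forcer? w′) c′
      in contradiction (before-w w′ uw′ (w≢w′ ∘ sym)) (<-asym (before-w′ w uw w≢w′))

  starts : StartsIn ChosenForcer (_∈ S)
  starts v with v ∈? S
  ... | yes v∈S = inj₁ v∈S
  ... | no v∉S = inj₂ (chosen-exists (forcer? v) (forcer-exists v∉S))

module _ {n} {R : Rel (Fin n) 0ℓ} where

  Star-last : ∀ {i v} → Star R i v → i ≡ v ⊎ ∃[ u ] Star R i u × R u v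
  Star-last ε = inj₁ refl
  Star-last (r ◅ p) with Star-last p
  ... | inj₁ refl = inj₂ (_ , ε , r)
  ... | inj₂ (u , q , r′) = inj₂ (u , r ◅ q , r′)

  Star-comparable : (∀ {u w w′} → R u w → R u w′ → w ≡ w′) →
                    ∀ {i u w} → Star R i u → Star R i w → Star R u w ⊎ Star R w u
  Star-comparable functional ε q = inj₁ q
  Star-comparable functional (r ◅ p) ε = inj₂ (r ◅ p)
  Star-comparable functional (r ◅ p) (r′ ◅ q) with functional r r′
  ... | refl = Star-comparable functional p q

  Star-from-end : ∀ {u w} → (∀ {x} → ¬ R u x) → Star R u w → u ≡ w
  Star-from-end end ε = refl
  Star-from-end end (r ◅ _) = contradiction r end

module Join {n} {G : Adj n} {R : Rel (Fin n) 0ℓ} (chains : IsChainSystem G R) {s t : Fin n}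
  (s-end : ∀ {w} → ¬ R s w) (t-start : ∀ {u} → ¬ R u t) (¬ts : ¬ R t s) (s≢t : s ≢ t)
  (st : G s t ≡ true) where
  open IsChainSystem chains

  R⁺ : Rel (Fin n) 0ℓ
  R⁺ u w = R u w ⊎ (u ≡ s × w ≡ t)

  isChainSystem⁺ : IsChainSystem G R⁺
  isChainSystem⁺ = record
    { decide     = λ u w → decide u w ⊎-dec ((u ≟ s) ×-dec (w ≟ t))
    ; edge       = λ { (inj₁ r) → edge r ; (inj₂ (refl , refl)) → st }
    ; functional = functional⁺
    ; injective  = injective⁺
    ; asymmetric = asymmetric⁺
    }
    where
    functional⁺ : ∀ {u w w′} → R⁺ u w → R⁺ u w′ → w ≡ w′
    functional⁺ (inj₁ r) (inj₁ r′) = functional r r′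
    functional⁺ (inj₁ r) (inj₂ (refl , _)) = contradiction r s-end
    functional⁺ (inj₂ (refl , _)) (inj₁ r′) = contradiction r′ s-end
    functional⁺ (inj₂ (_ , refl)) (inj₂ (_ , refl)) = refl

    injective⁺ : ∀ {u u′ w} → R⁺ u w → R⁺ u′ w → u ≡ u′
    injective⁺ (inj₁ r) (inj₁ r′) = injective r r′
    injective⁺ (inj₁ r) (inj₂ (_ , refl)) = contradiction r t-start
    injective⁺ (inj₂ (_ , refl)) (inj₁ r′) = contradiction r′ t-start
    injective⁺ (inj₂ (refl , _)) (inj₂ (refl , _)) = refl

    asymmetric⁺ : ∀ {u w} → R⁺ u w → ¬ R⁺ w u
    asymmetric⁺ (inj₁ r) (inj₁ r′) = asymmetric r r′
    asymmetric⁺ (inj₁ r) (inj₂ (refl , refl)) = ¬ts r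
    asymmetric⁺ (inj₂ (refl , refl)) (inj₁ r′) = ¬ts r′
    asymmetric⁺ (inj₂ (refl , refl)) (inj₂ (t≡s , _)) = s≢t (sym t≡s)

  starts⁺ : ∀ {P : Pred (Fin n) 0ℓ} → StartsIn R (λ v → P v ⊎ v ≡ t) → StartsIn R⁺ P
  starts⁺ starts v with starts v
  ... | inj₁ (inj₁ p) = inj₁ p
  ... | inj₁ (inj₂ refl) = inj₂ (s , inj₂ (refl , refl))
  ... | inj₂ (u , r) = inj₂ (u , inj₁ r)

-- The rank only makes the chain from s finite and membership in it decidable.
module Reversal {n} {G : Adj n} (G-sym : ∀ x y → G x y ≡ G y x)
  {R : Rel (Fin n) 0ℓ} (chains : IsChainSystem G R) {rank : Fin n → ℕ} (increasing : ∀ {u w} → R u w → rank u < rank w)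
  {s : Fin n} (s-start : ∀ {u} → ¬ R u s) where
  open IsChainSystem chains

  OnChain : Pred (Fin n) 0ℓ
  OnChain = Star R s

  OnChain-pred : ∀ {u v} → R u v → OnChain v → OnChain u
  OnChain-pred r p with Star-last p
  ... | inj₁ refl = contradiction r s-start
  ... | inj₂ (_ , q , r′) with injective r r′
  ...   | refl = q

  onChain? : ∀ v → Dec (OnChain v)
  onChain? v = go v (<-wellFounded (rank v))
    where
    go : ∀ v → Acc _<_ (rank v) → Dec (OnChain v)
    go v (acc smaller) with s ≟ v | any? (λ u → decide u v)
    ... | yes refl | _ = yes ε
    ... | no s≢v | no noPred = no λ p → [ s≢v , (λ (u , _ , r) → noPred (u , r)) ]′ (Star-last p)
    ... | no s≢v | yes (u , r) = Dec.map′ (_◅◅ r ◅ ε) (OnChain-pred r) (go u (smaller (increasing r)))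

  chain-end : ∃[ x ] OnChain x × (∀ {w} → ¬ R x w)
  chain-end = walk (suc B) s ε (s≤s (m≤m+n B (rank s)))
    where
    bound : ∃[ B ] ∀ v → rank v ≤ B
    bound = common-bound (λ v k → rank v ≤ k) (λ _ j≤k r≤j → ≤-trans r≤j j≤k) (λ v → rank v , ≤-refl)
    B : ℕ
    B = proj₁ bound

    walk : ∀ fuel u → OnChain u → B < fuel + rank u → ∃[ x ] OnChain x × (∀ {w} → ¬ R x w)
    walk zero u _ long = contradiction (proj₂ bound u) (<⇒≱ long)
    walk (suc fuel) u p long with any? (λ w → decide u w)
    ... | no none = u , p , λ r → none (_ , r)
    ... | yes (w , r) =
      walk fuel w (p ◅◅ r ◅ ε)
           (≤-trans long (subst (_≤ fuel + rank w) (+-suc fuel (rank u)) (+-monoʳ-≤ fuel (increasing r))))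

  end : Fin n
  end = proj₁ chain-end

  end-unique : ∀ {v} → OnChain v → (∀ {w} → ¬ R v w) → v ≡ end
  end-unique p v-end with Star-comparable functional p (proj₁ (proj₂ chain-end))
  ... | inj₁ v⇝end = Star-from-end v-end v⇝end
  ... | inj₂ end⇝v = sym (Star-from-end (proj₂ (proj₂ chain-end)) end⇝v)

  R⁻ : Rel (Fin n) 0ℓ
  R⁻ u w = (OnChain u × R w u) ⊎ (¬ OnChain u × R u w)

  R⁻⊆R∪R˘ : ∀ {u w} → R⁻ u w → R u w ⊎ R w u
  R⁻⊆R∪R˘ (inj₁ (_ , r)) = inj₂ r
  R⁻⊆R∪R˘ (inj₂ (_ , r)) = inj₁ r

  isChainSystem⁻ : IsChainSystem G R⁻
  isChainSystem⁻ = record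
    { decide     = λ u w → (onChain? u ×-dec decide w u) ⊎-dec (¬? (onChain? u) ×-dec decide u w)
    ; edge       = λ { {u} {w} (inj₁ (_ , r)) → trans (G-sym u w) (edge r) ; (inj₂ (_ , r)) → edge r }
    ; functional = functional⁻
    ; injective  = injective⁻
    ; asymmetric = asymmetric⁻
    }
    where
    functional⁻ : ∀ {u w w′} → R⁻ u w → R⁻ u w′ → w ≡ w′
    functional⁻ (inj₁ (_ , r)) (inj₁ (_ , r′)) = injective r r′
    functional⁻ (inj₁ (on , _)) (inj₂ (off , _)) = contradiction on off
    functional⁻ (inj₂ (off , _)) (inj₁ (on , _)) = contradiction on off
    functional⁻ (inj₂ (_ , r)) (inj₂ (_ , r′)) = functional r r′

    injective⁻ : ∀ {u u′ w} → R⁻ u w → R⁻ u′ w → u ≡ u′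
    injective⁻ (inj₁ (_ , r)) (inj₁ (_ , r′)) = functional r r′
    injective⁻ (inj₁ (on , r)) (inj₂ (off , r′)) = contradiction (OnChain-pred r′ (OnChain-pred r on)) off
    injective⁻ (inj₂ (off , r)) (inj₁ (on , r′)) = contradiction (OnChain-pred r (OnChain-pred r′ on)) off
    injective⁻ (inj₂ (_ , r)) (inj₂ (_ , r′)) = injective r r′

    asymmetric⁻ : ∀ {u w} → R⁻ u w → ¬ R⁻ w u
    asymmetric⁻ (inj₁ (_ , r)) (inj₁ (_ , r′)) = asymmetric r r′
    asymmetric⁻ (inj₁ (on , r)) (inj₂ (off , _)) = contradiction (OnChain-pred r on) off
    asymmetric⁻ (inj₂ (off , r)) (inj₁ (on , _)) = contradiction (OnChain-pred r on) off
    asymmetric⁻ (inj₂ (_ , r)) (inj₂ (_ , r′)) = asymmetric r r′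

  s-end⁻ : ∀ {w} → ¬ R⁻ s w
  s-end⁻ (inj₁ (_ , r)) = s-start r
  s-end⁻ (inj₂ (off , _)) = off ε

  start⁻ : ∀ {t} → t ≢ s → (∀ {u} → ¬ R u t) → ∀ {u} → ¬ R⁻ u t
  start⁻ t≢s t-start (inj₁ (on , r)) with Star-last (OnChain-pred r on)
  ... | inj₁ s≡t = t≢s (sym s≡t)
  ... | inj₂ (_ , _ , r′) = t-start r′
  start⁻ t≢s t-start (inj₂ (_ , r)) = t-start r

  starts⁻ : ∀ {P : Pred (Fin n) 0ℓ} → StartsIn R (λ v → P v ⊎ v ≡ s) → StartsIn R⁻ (λ v → P v ⊎ v ≡ end)
  starts⁻ starts v with onChain? v | starts v
  ... | yes on | _ with any? (λ w → decide v w)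
  ...   | yes (w , r) = inj₂ (w , inj₁ (on ◅◅ r ◅ ε , r))
  ...   | no none = inj₁ (inj₂ (end-unique on λ r → none (_ , r)))
  starts⁻ starts v | no off | inj₁ (inj₁ p) = inj₁ (inj₁ p)
  starts⁻ starts v | no off | inj₁ (inj₂ refl) = contradiction ε off
  starts⁻ starts v | no off | inj₂ (u , r) = inj₂ (u , inj₂ ((λ on → off (on ◅◅ r ◅ ε)) , r))

∨-true : ∀ {x y} → x ∨ y ≡ true → x ≡ true ⊎ y ≡ true
∨-true {true} _ = inj₁ refl
∨-true {false} y≡true = inj₂ y≡true

≟-true : ∀ {n} {x y : Fin n} → ⌊ x ≟ y ⌋ ≡ true → x ≡ y
≟-true {x = x} {y} h with x ≟ y
... | yes x≡y = x≡y

samePair-self : ∀ {n} (p q : Fin n) → samePair p q p q ≡ true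
samePair-self p q rewrite ≡-≟-identity _≟_ {p} refl | ≡-≟-identity _≟_ {q} refl = refl

samePair-flip : ∀ {n} (p q : Fin n) → samePair q p p q ≡ true
samePair-flip p q rewrite ≡-≟-identity _≟_ {p} refl | ≡-≟-identity _≟_ {q} refl = ∨-zeroʳ _

samePair-comm : ∀ {n} (x y p q : Fin n) → samePair x y p q ≡ samePair x y q p
samePair-comm x y p q = ∨-comm (⌊ x ≟ p ⌋ ∧ ⌊ y ≟ q ⌋) _

samePair-sound : ∀ {n} {x y p q : Fin n} → samePair x y p q ≡ true → (x ≡ p × y ≡ q) ⊎ (x ≡ q × y ≡ p)
samePair-sound {x = x} {y} {p} {q} h with ∨-true {⌊ x ≟ p ⌋ ∧ ⌊ y ≟ q ⌋} h
... | inj₁ h = inj₁ (≟-true (∧-conicalˡ _ _ h) , ≟-true (∧-conicalʳ _ _ h))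
... | inj₂ h = inj₂ (≟-true (∧-conicalˡ _ _ h) , ≟-true (∧-conicalʳ _ _ h))

removes adds : ∀ {n} (a b c d x y : Fin n) → Bool
removes a b c d x y = samePair x y a b ∨ samePair x y c d
adds a b c d x y = samePair x y a c ∨ samePair x y b d

data Removed {n} (a b c d : Fin n) : Fin n → Fin n → Set where
  ab : Removed a b c d a b
  ba : Removed a b c d b a
  cd : Removed a b c d c d
  dc : Removed a b c d d c

removes-sound : ∀ {n} {a b c d x y : Fin n} → removes a b c d x y ≡ true → Removed a b c d x y
removes-sound {a = a} {b} {c} {d} {x} {y} e with ∨-true {samePair x y a b} e
... | inj₁ e′ with samePair-sound {x = x} {y} {a} {b} e′
...   | inj₁ (refl , refl) = ab
...   | inj₂ (refl , refl) = ba
removes-sound {a = a} {b} {c} {d} {x} {y} e | inj₂ e′ with samePair-sound {x = x} {y} {c} {d} e′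
...   | inj₁ (refl , refl) = cd
...   | inj₂ (refl , refl) = dc

removes-complete : ∀ {n} {a b c d x y : Fin n} → Removed a b c d x y → removes a b c d x y ≡ true
removes-complete {a = a} {b} ab rewrite samePair-self a b = refl
removes-complete {a = a} {b} ba rewrite samePair-flip a b = refl
removes-complete {c = c} {d} cd rewrite samePair-self c d = ∨-zeroʳ _
removes-complete {c = c} {d} dc rewrite samePair-flip c d = ∨-zeroʳ _

module _ {n} {G : Adj n} {a b c d : Fin n} where

  switch-keeps : ∀ {x y} → removes a b c d x y ≡ false → G x y ≡ true → switch G a b c d x y ≡ true
  switch-keeps {x} {y} kept g rewrite kept with adds a b c d x y
  ... | true = refl
  ... | false = g

  switch-adds : ∀ {x y} → removes a b c d x y ≢ true → adds a b c d x y ≡ true → switch G a b c d x y ≡ true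
  switch-adds kept added rewrite ¬-not kept | added = refl

  switch-removes : ∀ {x y} → Removed a b c d x y → switch G a b c d x y ≡ false
  switch-removes removed rewrite removes-complete removed = refl

  module _ (G-sym : ∀ x y → G x y ≡ G y x) (sw : Is2Switch G a b c d) where
    private
      ab∈G : G a b ≡ true
      ab∈G = let (_ , _ , _ , _ , _ , _ , e , _) = sw in e
      cd∈G : G c d ≡ true
      cd∈G = let (_ , _ , _ , _ , _ , _ , _ , e , _) = sw in e
      ac∉G : G a c ≡ false
      ac∉G = let (_ , _ , _ , _ , _ , _ , _ , _ , e , _) = sw in e
      bd∉G : G b d ≡ false
      bd∉G = let (_ , _ , _ , _ , _ , _ , _ , _ , _ , e) = sw in e

    switch-ac : switch G a b c d a c ≡ true
    switch-ac = switch-adds {a} {c} (kept ∘ removes-sound) (removes-complete {a = a} {c} {b} {d} ab)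
      where
      kept : ¬ Removed a b c d a c
      kept ab = let (_ , _ , _ , b≢c , _) = sw in b≢c refl
      kept ba = let (a≢b , _) = sw in a≢b refl
      kept cd = let (_ , a≢c , _) = sw in a≢c refl
      kept dc = let (_ , _ , a≢d , _) = sw in a≢d refl

    switch-bd : switch G a b c d b d ≡ true
    switch-bd = switch-adds {b} {d} (kept ∘ removes-sound) (removes-complete {a = a} {c} {b} {d} cd)
      where
      b≢d : b ≢ d
      b≢d = let (_ , _ , _ , _ , b≢d , _) = sw in b≢d
      kept : ¬ Removed a b c d b d
      kept ab = b≢d refl
      kept ba = let (_ , _ , a≢d , _) = sw in a≢d refl
      kept cd = let (_ , _ , _ , b≢c , _) = sw in b≢c refl
      kept dc = b≢d refl

    Removed⇒edge : ∀ {x y} → Removed a b c d x y → G x y ≡ true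
    Removed⇒edge ab = ab∈G
    Removed⇒edge ba = trans (G-sym b a) ab∈G
    Removed⇒edge cd = cd∈G
    Removed⇒edge dc = trans (G-sym d c) cd∈G

    -- Removed a c b d lists the pairs added by the switch.
    Added⇒non-edge : ∀ {x y} → Removed a c b d x y → G x y ≡ false
    Added⇒non-edge ab = ac∉G
    Added⇒non-edge ba = trans (G-sym c a) ac∉G
    Added⇒non-edge cd = bd∉G
    Added⇒non-edge dc = trans (G-sym d b) bd∉G

    switch-involutive : ∀ x y → switch (switch G a b c d) a c b d x y ≡ G x y
    switch-involutive x y with adds a b c d x y in added | removes a b c d x y in removed
    ... | true | _ = sym (Added⇒non-edge (removes-sound added))
    ... | false | true = sym (Removed⇒edge (removes-sound removed))
    ... | false | false = refl

    Is2Switch-inverse : Is2Switch (switch G a b c d) a c b d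
    Is2Switch-inverse =
      let (a≢b , a≢c , a≢d , b≢c , b≢d , c≢d , _) = sw in
      a≢c , a≢b , a≢d , b≢c ∘ sym , c≢d , b≢d , switch-ac , switch-bd ,
      switch-removes ab , switch-removes cd

    Is2Switch-reverse : Is2Switch G b a d c
    Is2Switch-reverse =
      let (a≢b , a≢c , a≢d , b≢c , b≢d , c≢d , _) = sw in
      a≢b ∘ sym , b≢d , b≢c , a≢d , a≢c , c≢d ∘ sym ,
      trans (G-sym b a) ab∈G , trans (G-sym d c) cd∈G , bd∉G , ac∉G

  switch-reverse : ∀ x y → switch G a b c d x y ≡ switch G b a d c x y
  switch-reverse x y rewrite samePair-comm x y b a | samePair-comm x y d c
                           | ∨-comm (samePair x y b d) (samePair x y a c) = refl

module SwitchCut {n} {G G′ : Adj n} {a b c d : Fin n} (G′≗ : ∀ x y → G′ x y ≡ switch G a b c d x y)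
  {R : Rel (Fin n) 0ℓ} (chains : IsChainSystem G R) where
  open IsChainSystem chains

  R₀ : Rel (Fin n) 0ℓ
  R₀ u w = R u w × removes a b c d u w ≡ false

  isChainSystem₀ : IsChainSystem G′ R₀
  isChainSystem₀ = IsChainSystem-⊆ chains (λ u w → decide u w ×-dec (removes a b c d u w ≟ᵇ false)) proj₁
    λ {u} {w} (r , kept) → trans (G′≗ u w) (switch-keeps {G = G} {x = u} {w} kept (edge r))

  starts₀ : ∀ {P T : Pred (Fin n) 0ℓ} → StartsIn R P → (∀ {u w} → R u w → Removed a b c d u w → T w) →
            StartsIn R₀ (λ v → P v ⊎ T v)
  starts₀ starts target v with starts v
  ... | inj₁ p = inj₁ (inj₁ p)
  ... | inj₂ (u , r) with removes a b c d u v ≟ᵇ false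
  ...   | yes kept = inj₂ (u , r , kept)
  ...   | no ¬kept = inj₁ (inj₂ (target r (removes-sound (¬-not ¬kept))))

  cut-end : ∀ {u w} → R u w → Removed a b c d u w → ∀ {w′} → ¬ R₀ u w′
  cut-end r removed (r′ , kept) with functional r r′
  ... | refl = not-¬ kept (removes-complete removed)

  cut-start : ∀ {u w} → R u w → Removed a b c d u w → ∀ {u′} → ¬ R₀ u′ w
  cut-start r removed (r′ , kept) with injective r r′
  ... | refl = not-¬ kept (removes-complete removed)

module OrientedSwitch {n} {G G′ : Adj n} {a b c d : Fin n}
  (G-sym : ∀ x y → G x y ≡ G y x) (G′-sym : ∀ x y → G′ x y ≡ G′ y x)
  (sw : Is2Switch G a b c d) (G′≗ : ∀ x y → G′ x y ≡ switch G a b c d x y)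
  {R : Rel (Fin n) 0ℓ} (chains : IsChainSystem G R)
  {rank : Fin n → ℕ} (increasing : ∀ {u w} → R u w → rank u < rank w)
  {P : Pred (Fin n) 0ℓ} (starts : StartsIn R P) (ab∈R : R a b) where
  open IsChainSystem chains
  open SwitchCut G′≗ chains

  private
    a≢c : a ≢ c
    a≢c = let (_ , a≢c , _) = sw in a≢c

    b≢d : b ≢ d
    b≢d = let (_ , _ , _ , _ , b≢d , _) = sw in b≢d

    ac∈G′ : G′ a c ≡ true
    ac∈G′ = trans (G′≗ a c) (switch-ac G-sym sw)

    db∈G′ : G′ d b ≡ true
    db∈G′ = trans (G′-sym d b) (trans (G′≗ b d) (switch-bd G-sym sw))

  reverseAndJoin : R c d → ∃[ x ] ChainSystemStartingIn G′ (λ v → P v ⊎ v ≡ x)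
  reverseAndJoin cd∈R = V.end , record
    { R = J.R⁺ ; isChainSystem = J.isChainSystem⁺
    ; starts = J.starts⁺ (StartsIn-mono swap₂₃ (V.starts⁻ (StartsIn-mono assocˡ (starts₀ starts target)))) }
    where
    target : ∀ {u w} → R u w → Removed a b c d u w → w ≡ b ⊎ w ≡ d
    target _ ab = inj₁ refl
    target r ba = contradiction r (asymmetric ab∈R)
    target _ cd = inj₂ refl
    target r dc = contradiction r (asymmetric cd∈R)

    swap₂₃ : ∀ {A B C : Set} → (A ⊎ B) ⊎ C → (A ⊎ C) ⊎ B
    swap₂₃ = [ [ inj₁ ∘ inj₁ , inj₂ ]′ , inj₁ ∘ inj₂ ]′

    module V = Reversal G′-sym isChainSystem₀ (increasing ∘ proj₁) (cut-start cd∈R cd)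

    ¬bd : ¬ V.R⁻ b d
    ¬bd r = [ cut-start cd∈R cd , cut-start ab∈R ab ]′ (V.R⁻⊆R∪R˘ r)

    module J = Join V.isChainSystem⁻ V.s-end⁻ (V.start⁻ b≢d (cut-start ab∈R ab)) ¬bd (b≢d ∘ sym) db∈G′

  join : R d c → ∃[ x ] ChainSystemStartingIn G′ (λ v → P v ⊎ v ≡ x)
  join dc∈R = b , record
    { R = J.R⁺ ; isChainSystem = J.isChainSystem⁺
    ; starts = J.starts⁺ (StartsIn-mono assocˡ (starts₀ starts target)) }
    where
    target : ∀ {u w} → R u w → Removed a b c d u w → w ≡ b ⊎ w ≡ c
    target _ ab = inj₁ refl
    target r ba = contradiction r (asymmetric ab∈R)
    target r cd = contradiction r (asymmetric dc∈R)
    target _ dc = inj₂ refl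

    ¬ca : ¬ R₀ c a
    ¬ca (r , _) = not-¬ (Added⇒non-edge G-sym sw ba) (edge r)

    module J = Join isChainSystem₀ (cut-end ab∈R ab) (cut-start dc∈R dc) ¬ca a≢c ac∈G′

  cutOnly : ¬ R c d → ¬ R d c → ∃[ x ] ChainSystemStartingIn G′ (λ v → P v ⊎ v ≡ x)
  cutOnly ¬cd ¬dc = b , record { R = R₀ ; isChainSystem = isChainSystem₀ ; starts = starts₀ starts target }
    where
    target : ∀ {u w} → R u w → Removed a b c d u w → w ≡ b
    target _ ab = refl
    target r ba = contradiction r (asymmetric ab∈R)
    target r cd = contradiction r ¬cd
    target r dc = contradiction r ¬dc

  -- With the chain edge a → b: if also d → c, join a → c; if c → d, reverse the chain
  -- starting at d and join d → b; otherwise b is the only new start.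
  result : ∃[ x ] ChainSystemStartingIn G′ (λ v → P v ⊎ v ≡ x)
  result with decide c d | decide d c
  ... | yes cd∈R | _ = reverseAndJoin cd∈R
  ... | no _ | yes dc∈R = join dc∈R
  ... | no ¬cd | no ¬dc = cutOnly ¬cd ¬dc

-- The case b → a is the case a → b of the 2-switch (b, a, d, c), which yields the same
-- graph. If ab carries no chain edge, cutting cd creates at most one new start.
switch-chains : ∀ {n} {G G′ : Adj n} {a b c d : Fin n} →
  (∀ x y → G x y ≡ G y x) → (∀ x y → G′ x y ≡ G′ y x) →
  Is2Switch G a b c d → (∀ x y → G′ x y ≡ switch G a b c d x y) →
  ∀ {R : Rel (Fin n) 0ℓ} {rank : Fin n → ℕ} {P : Pred (Fin n) 0ℓ} →
  IsChainSystem G R → (∀ {u w} → R u w → rank u < rank w) → StartsIn R P →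
  ∃[ x ] ChainSystemStartingIn G′ (λ v → P v ⊎ v ≡ x)
switch-chains {G = G} {a = a} {b} {c} {d} G-sym G′-sym sw G′≗ {R} chains increasing starts
  with IsChainSystem.decide chains a b | IsChainSystem.decide chains b a
... | yes ab∈R | _ = OrientedSwitch.result G-sym G′-sym sw G′≗ chains increasing starts ab∈R
... | no _ | yes ba∈R =
  OrientedSwitch.result G-sym G′-sym (Is2Switch-reverse G-sym sw)
    (λ x y → trans (G′≗ x y) (switch-reverse {G = G} x y)) chains increasing starts ba∈R
... | no ¬ab | no ¬ba with IsChainSystem.decide chains c d
...   | yes cd∈R = d , record { R = R₀ ; isChainSystem = isChainSystem₀ ; starts = starts₀ starts target }
  where
  open SwitchCut G′≗ chains
  open IsChainSystem chains
  target : ∀ {u w} → R u w → Removed a b c d u w → w ≡ d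
  target r ab = contradiction r ¬ab
  target r ba = contradiction r ¬ba
  target _ cd = refl
  target r dc = contradiction r (asymmetric cd∈R)
...   | no ¬cd = c , record { R = R₀ ; isChainSystem = isChainSystem₀ ; starts = starts₀ starts target }
  where
  open SwitchCut G′≗ chains
  target : ∀ {u w} → R u w → Removed a b c d u w → w ≡ c
  target r ab = contradiction r ¬ab
  target r ba = contradiction r ¬ba
  target r cd = contradiction r ¬cd
  target _ dc = refl

forcingSet-after-switch : ∀ {n} {G G′ : Adj n} {a b c d : Fin n} →
  (∀ x y → G x y ≡ G y x) → Is2Switch G a b c d → (∀ x y → G′ x y ≡ switch G a b c d x y) → IsForest G′ →
  ∀ {S} → IsForcingSet G S → ∃[ S′ ] IsForcingSet G′ S′ × ∣ S′ ∣ ≤ suc ∣ S ∣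
forcingSet-after-switch {n} {G′ = G′} G-sym sw G′≗ forest′ {S} forcing =
  S ∪ ⁅ x ⁆ , chainStarts-isForcingSet forest′ (ChainSystemStartingIn-mono into-S∪x (proj₂ switched)) , size
  where
  module FC = ForcingChains forcing

  switched : ∃[ x ] ChainSystemStartingIn G′ (λ v → v ∈ S ⊎ v ≡ x)
  switched = switch-chains G-sym (proj₁ (proj₁ forest′)) sw G′≗ FC.isChainSystem FC.round-increasing FC.starts

  x : Fin n
  x = proj₁ switched

  into-S∪x : ∀ {v} → v ∈ S ⊎ v ≡ x → v ∈ S ∪ ⁅ x ⁆
  into-S∪x (inj₁ v∈S) = x∈p∪q⁺ (inj₁ v∈S)
  into-S∪x (inj₂ refl) = x∈p∪q⁺ (inj₂ (x∈⁅x⁆ x))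

  size : ∣ S ∪ ⁅ x ⁆ ∣ ≤ suc ∣ S ∣
  size = ≤-trans (∣p∪q∣≤∣p∣+∣q∣ S ⁅ x ⁆)
                 (≤-reflexive (trans (cong (∣ S ∣ +_) (∣⁅x⁆∣≡1 x)) (+-comm ∣ S ∣ 1)))

zeroForcingNumber-switch-≤ : ∀ {n} {G G′ : Adj n} {a b c d : Fin n} →
  (∀ x y → G x y ≡ G y x) → Is2Switch G a b c d → (∀ x y → G′ x y ≡ switch G a b c d x y) → IsForest G′ →
  ∀ {z z′} → IsZeroForcingNumber G z → IsZeroForcingNumber G′ z′ → z′ ≤ suc z
zeroForcingNumber-switch-≤ G-sym sw G′≗ forest′ ((S , forcing , ∣S∣≡z) , _) (_ , minimal′) =
  let (S′ , forcing′ , ∣S′∣≤) = forcingSet-after-switch G-sym sw G′≗ forest′ forcing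
  in ≤-trans (minimal′ S′ forcing′) (subst (λ k → ∣ S′ ∣ ≤ suc k) ∣S∣≡z ∣S′∣≤)

mainTheorem16 : ∀ (n : ℕ) (F : Adj n) (a b c d : Fin n) →
    IsForest F → Is2Switch F a b c d → IsForest (switch F a b c d) →
    ∀ (z z′ : ℕ) → IsZeroForcingNumber F z → IsZeroForcingNumber (switch F a b c d) z′ →
    (z ≤ suc z′) × (z′ ≤ suc z)
mainTheorem16 n F a b c d forest sw forest′ z z′ Z Z′ =
  zeroForcingNumber-switch-≤ τF-sym (Is2Switch-inverse F-sym sw) F≗ forest Z′ Z ,
  zeroForcingNumber-switch-≤ F-sym sw (λ _ _ → refl) forest′ Z Z′
  where
  F-sym : ∀ x y → F x y ≡ F y x
  F-sym = proj₁ (proj₁ forest)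

  τF-sym : ∀ x y → switch F a b c d x y ≡ switch F a b c d y x
  τF-sym = proj₁ (proj₁ forest′)

  F≗ : ∀ x y → F x y ≡ switch (switch F a b c d) a c b d x y
  F≗ x y = sym (switch-involutive F-sym sw x y)
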